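{- Let $v_1\to v_2\to\cdots\to v_n$ be a directed path carrying only green pebbles, with $g_i\ge 0$ pebbles on $v_i$. Then the game value of this \textsc{blocking pebbles} position is the nimber $*\big(\bigoplus_{1\le k\le n/2} g_{2k}\big)$, the nim sum of the numbers of pebbles on the even-indexed vertices.
   Context: \textsc{Blocking pebbles} with green pebbles only is an impartial game on a finite directed acyclic graph with a number of (green) pebbles on each vertex. A move by either player: choose a vertex $v$ and either (1) move a positive number of pebbles from $v$ to a single in-neighbour $u$ of $v$ (arc $u\to v$) at no cost, or (2) remove two pebbles from $v$ and place one pebble on an out-neighbour $w$ of $v$ (arc $v\to w$). Normal play. $\oplus$ is nim sum (binary addition without carry); $*n$ is the nimber $n$. -}

module Defs where

open import Data.Nat using (ℕ; zero; suc; _+_; _*_; _∸_; _≤_; _<_)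
open import Data.Nat.DivMod using (_/_; _%_)
open import Data.Fin using (Fin; toℕ)
open import Data.Vec using (Vec; []; _∷_; lookup; _[_]%=_)
open import Data.Product using (Σ; _×_; _,_)
open import Relation.Binary.PropositionalEquality using (_≡_; _≢_)

-- Nim sum (bitwise xor without carry) on ℕ.
-- nimSumFuel f a b processes the lowest f bits; fuel a + b is always
-- enough since every n has at most n binary digits.

nimSumFuel : ℕ → ℕ → ℕ → ℕ
nimSumFuel zero    a b = 0
nimSumFuel (suc f) a b =
  ((a % 2 + b % 2) % 2) + 2 * nimSumFuel f (a / 2) (b / 2)

_⊕_ : ℕ → ℕ → ℕ
a ⊕ b = nimSumFuel (a + b) a b

infixl 6 _⊕_

-- A position is a vector of pebble counts; index i : Fin n (0-based)
-- stands for the vertex v_{i+1}.  The arcs are exactly i → i+1.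

Position : ℕ → Set
Position n = Vec ℕ n

data Move {n : ℕ} (p : Position n) : Position n → Set where
  shift : (j i : Fin n) → toℕ i ≡ suc (toℕ j) →
          (k : ℕ) → 1 ≤ k → k ≤ lookup p i →
          Move p ((p [ i ]%= (λ x → x ∸ k)) [ j ]%= (λ x → x + k))
  jump  : (i j : Fin n) → toℕ j ≡ suc (toℕ i) →
          2 ≤ lookup p i →
          Move p ((p [ i ]%= (λ x → x ∸ 2)) [ j ]%= suc)

-- Grundy value (Sprague–Grundy): HasGrundy p g means g is the mex of
-- the Grundy values of the options of p, i.e. the game value of p is
-- the nimber *g.
data HasGrundy {n : ℕ} (p : Position n) (g : ℕ) : Set where
  mex : (∀ q → Move p q → Σ ℕ (λ h → HasGrundy q h × h ≢ g)) →
        (∀ m → m < g → Σ (Position n) (λ q → Move p q × HasGrundy q m)) →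
        HasGrundy p g

-- Nim sum of the pebble counts on the even-indexed vertices
-- v₂, v₄, … (1-based), i.e. the 0-based odd positions.
evenNimSum : {n : ℕ} → Position n → ℕ
evenNimSum []               = 0
evenNimSum (x ∷ [])         = 0
evenNimSum (x ∷ y ∷ rest)   = y ⊕ evenNimSum rest

-- Every move changes the pebble counts on two adjacent vertices, exactly one of which is
-- even-indexed, so the nim sum E of the even-indexed counts changes along every move. Conversely,
-- given m < E, the even-indexed counts behave like Nim heaps: some g_{2k} can be lowered to
-- g_{2k} ⊕ E ⊕ m, and the surplus pebbles are shifted back onto v_{2k-1}, which does not count.
-- Finally the game is finite because a weighted pebble count decreases along every move, so
-- E satisfies the mex recursion by well-founded induction.
module Submission where

open import Defs
open import Algebra.Bundles using (AbelianGroup)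
open import Algebra.Structures using (IsAbelianGroup)
import Algebra.Properties.AbelianGroup as AbelianGroupProperties
import Algebra.Properties.CommutativeSemigroup as CommutativeSemigroupProperties
open import Data.Bool using (Bool; true; false; not; _xor_)
open import Data.Bool.Properties using (xor-comm; xor-assoc; xor-same; xor-identityʳ; not-involutive; not-injective)
open import Data.Nat using (ℕ; zero; suc; _+_; _*_; _^_; _∸_; _/_; _%_; _≤_; _<_; z≤n; s≤s; z<s; >-nonZero)
open import Data.Nat.Properties
open import Data.Nat.DivMod using (m≡m%n+[m/n]*n; [m+kn]%n≡m%n; m<n⇒m%n≡m; m*n%n≡0; m<n⇒m/n≡0; m*n/n≡m; +-distrib-/; m/n≤m; m/n<m; /-monoˡ-≤)
open import Data.Nat.Induction using (<-rec; <-wellFounded)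
open import Data.Nat.Tactic.RingSolver using (solve-∀)
open import Data.Fin using (Fin; zero; suc; toℕ; inject₁)
open import Data.Fin.Properties using (toℕ-inject₁)
open import Data.Vec using ([]; _∷_; lookup; _[_]%=_)
open import Data.Product using (_×_; _,_; ∃-syntax; Σ-syntax)
open import Data.Sum as Sum using (_⊎_; inj₁; inj₂)
open import Function using (id; _∘_; flip)
open import Induction.WellFounded using (WellFounded; Acc; acc; module Subrelation)
import Relation.Binary.Construct.On as On
open import Level using (0ℓ)
open import Relation.Binary.PropositionalEquality
open import Relation.Binary.Definitions using (tri<; tri≈; tri>)
open import Relation.Nullary using (contradiction)

fromBit : Bool → ℕ
fromBit false = 0
fromBit true  = 1

odd : ℕ → Bool
odd 0             = false
odd 1             = true
odd (suc (suc n)) = odd n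

odd-suc : ∀ n → odd (suc n) ≡ not (odd n)
odd-suc 0             = refl
odd-suc 1             = refl
odd-suc (suc (suc n)) = odd-suc n

not-odd-suc : ∀ n → not (odd (suc n)) ≡ odd n
not-odd-suc n = trans (cong not (odd-suc n)) (not-involutive (odd n))

fromBit-odd : ∀ x → fromBit (odd x) ≡ x % 2
fromBit-odd 0             = refl
fromBit-odd 1             = refl
fromBit-odd (suc (suc x)) = fromBit-odd x

binary-expansion : ∀ x → fromBit (odd x) + 2 * (x / 2) ≡ x
binary-expansion x = begin
  fromBit (odd x) + 2 * (x / 2) ≡⟨ cong₂ _+_ (fromBit-odd x) (*-comm 2 (x / 2)) ⟩
  x % 2 + x / 2 * 2             ≡⟨ m≡m%n+[m/n]*n x 2 ⟨
  x                             ∎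
  where open ≡-Reasoning

fromBit<2 : ∀ b → fromBit b < 2
fromBit<2 false = s≤s z≤n
fromBit<2 true  = s≤s (s≤s z≤n)

odd-expansion : ∀ b h → odd (fromBit b + 2 * h) ≡ b
odd-expansion b h = fromBit-injective (begin
  fromBit (odd (fromBit b + 2 * h)) ≡⟨ fromBit-odd (fromBit b + 2 * h) ⟩
  (fromBit b + 2 * h) % 2           ≡⟨ cong (λ t → (fromBit b + t) % 2) (*-comm 2 h) ⟩
  (fromBit b + h * 2) % 2           ≡⟨ [m+kn]%n≡m%n (fromBit b) h 2 ⟩
  fromBit b % 2                     ≡⟨ m<n⇒m%n≡m (fromBit<2 b) ⟩
  fromBit b                         ∎)
  where
  open ≡-Reasoning
  fromBit-injective : ∀ {b c} → fromBit b ≡ fromBit c → b ≡ c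
  fromBit-injective {false} {false} _ = refl
  fromBit-injective {true}  {true}  _ = refl

half-expansion : ∀ b h → (fromBit b + 2 * h) / 2 ≡ h
half-expansion b h = begin
  (fromBit b + 2 * h) / 2   ≡⟨ cong (λ t → (fromBit b + t) / 2) (*-comm 2 h) ⟩
  (fromBit b + h * 2) / 2   ≡⟨ +-distrib-/ (fromBit b) (h * 2) no-carry ⟩
  fromBit b / 2 + h * 2 / 2 ≡⟨ cong₂ _+_ (m<n⇒m/n≡0 (fromBit<2 b)) (m*n/n≡m h 2) ⟩
  h                         ∎
  where
  open ≡-Reasoning
  no-carry : fromBit b % 2 + (h * 2) % 2 < 2
  no-carry = subst (_< 2) (sym (begin
    fromBit b % 2 + (h * 2) % 2 ≡⟨ cong₂ _+_ (m<n⇒m%n≡m (fromBit<2 b)) (m*n%n≡0 h 2) ⟩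
    fromBit b + 0               ≡⟨ +-identityʳ (fromBit b) ⟩
    fromBit b                   ∎)) (fromBit<2 b)

half-≤ : ∀ {x k} → x ≤ suc k → x / 2 ≤ k
half-≤ {zero}  _     = z≤n
half-≤ {suc x} x≤1+k = ≤-pred (≤-trans (m/n<m (suc x) 2 (s≤s (s≤s z≤n))) x≤1+k)

nimSumFuel-0 : ∀ f → nimSumFuel f 0 0 ≡ 0
nimSumFuel-0 zero    = refl
nimSumFuel-0 (suc f) = cong (2 *_) (nimSumFuel-0 f)

nimSumFuel-stable : ∀ {f g a b} → a ≤ f → b ≤ f → a ≤ g → b ≤ g →
                    nimSumFuel f a b ≡ nimSumFuel g a b
nimSumFuel-stable {zero}  {g}     z≤n z≤n _   _   = sym (nimSumFuel-0 g)
nimSumFuel-stable {suc f} {zero}  _   _   z≤n z≤n = nimSumFuel-0 (suc f)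
nimSumFuel-stable {suc f} {suc g} {a} {b} a≤f b≤f a≤g b≤g =
  cong (λ t → (a % 2 + b % 2) % 2 + 2 * t)
       (nimSumFuel-stable (half-≤ a≤f) (half-≤ b≤f) (half-≤ a≤g) (half-≤ b≤g))

fromBit-xor : ∀ b c → (fromBit b + fromBit c) % 2 ≡ fromBit (b xor c)
fromBit-xor false false = refl
fromBit-xor false true  = refl
fromBit-xor true  false = refl
fromBit-xor true  true  = refl

⊕-expansion : ∀ a b → a ⊕ b ≡ fromBit (odd a xor odd b) + 2 * ((a / 2) ⊕ (b / 2))
⊕-expansion a b = begin
  nimSumFuel (a + b) a b
    ≡⟨ nimSumFuel-stable (m≤m+n a b) (m≤n+m b a) (m≤n⇒m≤1+n (m≤m+n a b)) (m≤n⇒m≤1+n (m≤n+m b a)) ⟩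
  (a % 2 + b % 2) % 2 + 2 * nimSumFuel (a + b) (a / 2) (b / 2)
    ≡⟨ cong₂ (λ u v → u + 2 * v) low high ⟩
  fromBit (odd a xor odd b) + 2 * ((a / 2) ⊕ (b / 2)) ∎
  where
  open ≡-Reasoning
  low : (a % 2 + b % 2) % 2 ≡ fromBit (odd a xor odd b)
  low = trans (cong₂ (λ u v → (u + v) % 2) (sym (fromBit-odd a)) (sym (fromBit-odd b)))
              (fromBit-xor (odd a) (odd b))
  high : nimSumFuel (a + b) (a / 2) (b / 2) ≡ (a / 2) ⊕ (b / 2)
  high = nimSumFuel-stable (≤-trans (m/n≤m a 2) (m≤m+n a b)) (≤-trans (m/n≤m b 2) (m≤n+m b a))
                           (m≤m+n (a / 2) (b / 2)) (m≤n+m (b / 2) (a / 2))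

odd-⊕ : ∀ a b → odd (a ⊕ b) ≡ odd a xor odd b
odd-⊕ a b = trans (cong odd (⊕-expansion a b)) (odd-expansion (odd a xor odd b) ((a / 2) ⊕ (b / 2)))

half-⊕ : ∀ a b → (a ⊕ b) / 2 ≡ (a / 2) ⊕ (b / 2)
half-⊕ a b = trans (cong (_/ 2) (⊕-expansion a b)) (half-expansion (odd a xor odd b) ((a / 2) ⊕ (b / 2)))

bit : ℕ → ℕ → Bool
bit zero    x = odd x
bit (suc i) x = bit i (x / 2)

bit-⊕ : ∀ i a b → bit i (a ⊕ b) ≡ bit i a xor bit i b
bit-⊕ zero    a b = odd-⊕ a b
bit-⊕ (suc i) a b = trans (cong (bit i) (half-⊕ a b)) (bit-⊕ i (a / 2) (b / 2))

bit-0 : ∀ i → bit i 0 ≡ false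
bit-0 zero    = refl
bit-0 (suc i) = bit-0 i

bit-ext : ∀ {x y} → (∀ i → bit i x ≡ bit i y) → x ≡ y
bit-ext {x} {y} = bounded (x + y) (m≤m+n x y) (m≤n+m y x)
  where
  bounded : ∀ k {x y} → x ≤ k → y ≤ k → (∀ i → bit i x ≡ bit i y) → x ≡ y
  bounded zero    z≤n z≤n _ = refl
  bounded (suc k) {x} {y} x≤ y≤ same = begin
    x                             ≡⟨ binary-expansion x ⟨
    fromBit (odd x) + 2 * (x / 2) ≡⟨ cong₂ (λ b h → fromBit b + 2 * h) (same zero)
                                           (bounded k (half-≤ x≤) (half-≤ y≤) (same ∘ suc)) ⟩
    fromBit (odd y) + 2 * (y / 2) ≡⟨ binary-expansion y ⟩
    y                             ∎
    where open ≡-Reasoning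

⊕-comm : ∀ a b → a ⊕ b ≡ b ⊕ a
⊕-comm a b = bit-ext λ i → begin
  bit i (a ⊕ b)       ≡⟨ bit-⊕ i a b ⟩
  bit i a xor bit i b ≡⟨ xor-comm (bit i a) (bit i b) ⟩
  bit i b xor bit i a ≡⟨ bit-⊕ i b a ⟨
  bit i (b ⊕ a)       ∎
  where open ≡-Reasoning

⊕-assoc : ∀ a b c → (a ⊕ b) ⊕ c ≡ a ⊕ (b ⊕ c)
⊕-assoc a b c = bit-ext λ i → begin
  bit i ((a ⊕ b) ⊕ c)               ≡⟨ trans (bit-⊕ i (a ⊕ b) c) (cong (_xor bit i c) (bit-⊕ i a b)) ⟩
  (bit i a xor bit i b) xor bit i c ≡⟨ xor-assoc (bit i a) (bit i b) (bit i c) ⟩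
  bit i a xor (bit i b xor bit i c) ≡⟨ trans (bit-⊕ i a (b ⊕ c)) (cong (bit i a xor_) (bit-⊕ i b c)) ⟨
  bit i (a ⊕ (b ⊕ c))               ∎
  where open ≡-Reasoning

⊕-identityʳ : ∀ a → a ⊕ 0 ≡ a
⊕-identityʳ a = bit-ext λ i →
  trans (bit-⊕ i a 0) (trans (cong (bit i a xor_) (bit-0 i)) (xor-identityʳ (bit i a)))

⊕-self : ∀ a → a ⊕ a ≡ 0
⊕-self a = bit-ext λ i → trans (bit-⊕ i a a) (trans (xor-same (bit i a)) (sym (bit-0 i)))

⊕-isAbelianGroup : IsAbelianGroup _≡_ _⊕_ 0 id
⊕-isAbelianGroup = record
  { isGroup = record
    { isMonoid = record
      { isSemigroup = record
        { isMagma = record { isEquivalence = isEquivalence ; ∙-cong = cong₂ _⊕_ }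
        ; assoc   = ⊕-assoc
        }
      ; identity = (λ a → trans (⊕-comm 0 a) (⊕-identityʳ a)) , ⊕-identityʳ
      }
    ; inverse = ⊕-self , ⊕-self
    ; ⁻¹-cong = id
    }
  ; comm = ⊕-comm
  }

⊕-abelianGroup : AbelianGroup 0ℓ 0ℓ
⊕-abelianGroup = record { isAbelianGroup = ⊕-isAbelianGroup }

open AbelianGroupProperties ⊕-abelianGroup
  using (∙-cancelˡ; ∙-cancelʳ) renaming (\\-leftDividesˡ to ⊕-cancel-self)
open CommutativeSemigroupProperties (AbelianGroup.commutativeSemigroup ⊕-abelianGroup)
  using (x∙yz≈y∙xz; xy∙z≈xz∙y)

half-<⇒< : ∀ {x y} → x / 2 < y / 2 → x < y
half-<⇒< x/2<y/2 = ≰⇒> λ y≤x → <⇒≱ x/2<y/2 (/-monoˡ-≤ 2 y≤x)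

<-by-halves : ∀ {x y} → x < y → x / 2 < y / 2 ⊎ (x / 2 ≡ y / 2 × odd x ≡ false × odd y ≡ true)
<-by-halves {x} {y} x<y with <-cmp (x / 2) (y / 2)
... | tri< x/2<y/2 _ _ = inj₁ x/2<y/2
... | tri> _ _ y/2<x/2 = contradiction (half-<⇒< y/2<x/2) (<-asym x<y)
... | tri≈ _ halves _  = inj₂ (halves , lowBits (odd x) (odd y) (+-cancelʳ-< (2 * (y / 2)) _ _ x<y′))
  where
  x<y′ : fromBit (odd x) + 2 * (y / 2) < fromBit (odd y) + 2 * (y / 2)
  x<y′ = subst₂ _<_ (trans (sym (binary-expansion x)) (cong (λ h → fromBit (odd x) + 2 * h) halves))
                    (sym (binary-expansion y)) x<y
  lowBits : ∀ b c → fromBit b < fromBit c → b ≡ false × c ≡ true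
  lowBits false true  _        = refl , refl
  lowBits false false ()
  lowBits true  true  (s≤s ())
  lowBits true  false ()

⊕-1-< : ∀ {x} → odd x ≡ true → x ⊕ 1 < x
⊕-1-< {x} x-odd = begin-strict
  x ⊕ 1                          ≡⟨ ⊕-expansion x 1 ⟩
  fromBit (odd x xor true) + 2 * ((x / 2) ⊕ 0)
    ≡⟨ cong₂ (λ b h → fromBit (b xor true) + 2 * h) x-odd (⊕-identityʳ (x / 2)) ⟩
  2 * (x / 2)                    <⟨ n<1+n (2 * (x / 2)) ⟩
  fromBit true + 2 * (x / 2)     ≡⟨ cong (λ b → fromBit b + 2 * (x / 2)) x-odd ⟨
  fromBit (odd x) + 2 * (x / 2)  ≡⟨ binary-expansion x ⟩
  x                              ∎
  where open ≤-Reasoning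

-- x ⊕ d < x says that the leading bit of d is set in x; a bit set in a ⊕ r is set in a or in r.
-- The proof strips trailing bits of d until the leading one is its lowest, so that d = 1.
⊕-lowers-summand : ∀ d a r → (a ⊕ r) ⊕ d < a ⊕ r → a ⊕ d < a ⊎ r ⊕ d < r
⊕-lowers-summand = <-rec _ step
  where
  step : ∀ d → (∀ {e} → e < d → ∀ a r → (a ⊕ r) ⊕ e < a ⊕ r → a ⊕ e < a ⊎ r ⊕ e < r) →
         ∀ a r → (a ⊕ r) ⊕ d < a ⊕ r → a ⊕ d < a ⊎ r ⊕ d < r
  step zero _ a r lowered = contradiction (subst (_< a ⊕ r) (⊕-identityʳ (a ⊕ r)) lowered) (<-irrefl refl)
  step d@(suc _) rec a r lowered with <-by-halves lowered
  ... | inj₁ halves< = Sum.map lift lift (rec (m/n<m d 2 (s≤s (s≤s z≤n))) (a / 2) (r / 2) halves<′)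
    where
    lift : ∀ {x} → (x / 2) ⊕ (d / 2) < x / 2 → x ⊕ d < x
    lift {x} h = half-<⇒< (subst (_< x / 2) (sym (half-⊕ x d)) h)
    halves<′ : ((a / 2) ⊕ (r / 2)) ⊕ (d / 2) < (a / 2) ⊕ (r / 2)
    halves<′ = subst₂ _<_ (trans (half-⊕ (a ⊕ r) d) (cong (_⊕ (d / 2)) (half-⊕ a r))) (half-⊕ a r) halves<
  ... | inj₂ (halves≡ , s⊕d-even , s-odd) = subst (λ e → a ⊕ e < a ⊎ r ⊕ e < r) (sym d≡1)
          (Sum.map ⊕-1-< ⊕-1-< (xor-true (odd a) (odd r) (trans (sym (odd-⊕ a r)) s-odd)))
    where
    s = a ⊕ r
    d/2≡0 : d / 2 ≡ 0
    d/2≡0 = ∙-cancelˡ (s / 2) (d / 2) 0 (trans (sym (half-⊕ s d)) (trans halves≡ (sym (⊕-identityʳ (s / 2)))))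
    d-odd : odd d ≡ true
    d-odd = not-injective (trans (cong (_xor odd d) (sym s-odd)) (trans (sym (odd-⊕ s d)) s⊕d-even))
    d≡1 : d ≡ 1
    d≡1 = trans (sym (binary-expansion d)) (cong₂ (λ b h → fromBit b + 2 * h) d-odd d/2≡0)
    xor-true : ∀ b c → b xor c ≡ true → b ≡ true ⊎ c ≡ true
    xor-true true  _    _ = inj₁ refl
    xor-true false true _ = inj₂ refl

-- Index i stands for the vertex v_{i+1}, so evenNimSum counts exactly the indices with odd (toℕ i).
evenNimSum-update-even : ∀ {n} (p : Position n) (i : Fin n) (f : ℕ → ℕ) → odd (toℕ i) ≡ false →
                         evenNimSum (p [ i ]%= f) ≡ evenNimSum p
evenNimSum-update-even (x ∷ [])       zero          f _    = refl
evenNimSum-update-even (x ∷ y ∷ rest) zero          f _    = refl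
evenNimSum-update-even (x ∷ y ∷ rest) (suc zero)    f ()
evenNimSum-update-even (x ∷ y ∷ rest) (suc (suc i)) f even = cong (y ⊕_) (evenNimSum-update-even rest i f even)

evenNimSum-update-odd : ∀ {n} (p : Position n) (i : Fin n) (f : ℕ → ℕ) → odd (toℕ i) ≡ true →
                        ∃[ r ] evenNimSum p ≡ lookup p i ⊕ r × evenNimSum (p [ i ]%= f) ≡ f (lookup p i) ⊕ r
evenNimSum-update-odd (x ∷ [])       zero          f ()
evenNimSum-update-odd (x ∷ y ∷ rest) zero          f ()
evenNimSum-update-odd (x ∷ y ∷ rest) (suc zero)    f _   = evenNimSum rest , refl , refl
evenNimSum-update-odd (x ∷ y ∷ rest) (suc (suc i)) f odd-i
  with evenNimSum-update-odd rest i f odd-i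
... | r , before , after =
  y ⊕ r , trans (cong (y ⊕_) before) (x∙yz≈y∙xz y (lookup rest i) r)
        , trans (cong (y ⊕_) after) (x∙yz≈y∙xz y (f (lookup rest i)) r)

evenNimSum-update-adjacent-≢ : ∀ {n} (p : Position n) {u v : Fin n} {f g : ℕ → ℕ} →
                               odd (toℕ v) ≡ not (odd (toℕ u)) →
                               f (lookup p u) ≢ lookup p u → (∀ x → g x ≢ x) →
                               evenNimSum ((p [ u ]%= f) [ v ]%= g) ≢ evenNimSum p
evenNimSum-update-adjacent-≢ p {u} {v} {f} {g} parity f-moves g-moves with odd (toℕ u) in odd-u
... | true with evenNimSum-update-odd p u f odd-u
...   | r , before , after = λ same → f-moves (∙-cancelʳ r _ _
          (trans (sym after) (trans (sym (evenNimSum-update-even (p [ u ]%= f) v g parity)) (trans same before))))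
evenNimSum-update-adjacent-≢ p {u} {v} {f} {g} parity f-moves g-moves | false
  with evenNimSum-update-odd (p [ u ]%= f) v g parity
...   | r , before , after = λ same → g-moves _ (∙-cancelʳ r _ _
          (trans (sym after) (trans same (trans (sym (evenNimSum-update-even p u f odd-u)) before))))

move-changes-evenNimSum : ∀ {n} {p q : Position n} → Move p q → evenNimSum q ≢ evenNimSum p
move-changes-evenNimSum {p = p} (shift j i i≡1+j k@(suc _) _ k≤pᵢ) =
  evenNimSum-update-adjacent-≢ p (sym (trans (cong (not ∘ odd) i≡1+j) (not-odd-suc (toℕ j))))
    (<⇒≢ (∸-monoʳ-< z<s k≤pᵢ)) (λ x → m+1+n≢m x)
move-changes-evenNimSum {p = p} (jump i j j≡1+i 2≤pᵢ) =
  evenNimSum-update-adjacent-≢ p (trans (cong odd j≡1+i) (odd-suc (toℕ i)))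
    (<⇒≢ (∸-monoʳ-< z<s 2≤pᵢ)) (λ x → 1+n≢n)

lowerable-odd-vertex : ∀ {n} (p : Position n) d → evenNimSum p ⊕ d < evenNimSum p →
                     ∃[ i ] odd (toℕ i) ≡ true × lookup p i ⊕ d < lookup p i
lowerable-odd-vertex []             d lowered = contradiction lowered n≮0
lowerable-odd-vertex (x ∷ [])       d lowered = contradiction lowered n≮0
lowerable-odd-vertex (x ∷ y ∷ rest) d lowered with ⊕-lowers-summand d y (evenNimSum rest) lowered
... | inj₁ y-lowered    = suc zero , refl , y-lowered
... | inj₂ rest-lowered with lowerable-odd-vertex rest d rest-lowered
...   | i , odd-i , i-lowered = suc (suc i) , odd-i , i-lowered

in-neighbour : ∀ {n} (i : Fin n) → odd (toℕ i) ≡ true → Σ[ j ∈ Fin n ] toℕ i ≡ suc (toℕ j)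
in-neighbour (suc i) _ = inject₁ i , cong suc (sym (toℕ-inject₁ i))

move-to-smaller-evenNimSum : ∀ {n} (p : Position n) {m} → m < evenNimSum p → ∃[ q ] Move p q × evenNimSum q ≡ m
move-to-smaller-evenNimSum p {m} m<E
  with lowerable-odd-vertex p (evenNimSum p ⊕ m) (subst (_< evenNimSum p) (sym (⊕-cancel-self (evenNimSum p) m)) m<E)
... | i , odd-i , lowered with in-neighbour i odd-i
...   | j , i≡1+j = q , shift j i i≡1+j k (m<n⇒0<n∸m lowered) (m∸n≤m y (y ⊕ d)) , value
  where
  d = evenNimSum p ⊕ m
  y = lookup p i
  k = y ∸ (y ⊕ d)
  p′ = p [ i ]%= (_∸ k)
  q = p′ [ j ]%= (_+ k)
  j-even : odd (toℕ j) ≡ false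
  j-even = trans (sym (not-odd-suc (toℕ j))) (cong not (trans (cong odd (sym i≡1+j)) odd-i))
  value : evenNimSum q ≡ m
  value with evenNimSum-update-odd p i (_∸ k) odd-i
  ... | r , before , after = begin
    evenNimSum q         ≡⟨ evenNimSum-update-even p′ j (_+ k) j-even ⟩
    evenNimSum p′        ≡⟨ after ⟩
    (y ∸ k) ⊕ r          ≡⟨ cong (_⊕ r) (m∸[m∸n]≡n (<⇒≤ lowered)) ⟩
    (y ⊕ d) ⊕ r          ≡⟨ xy∙z≈xz∙y y d r ⟩
    (y ⊕ r) ⊕ d          ≡⟨ cong (_⊕ d) before ⟨
    evenNimSum p ⊕ d     ≡⟨ ⊕-cancel-self (evenNimSum p) m ⟩
    m                    ∎
    where open ≡-Reasoning

-- Pebbles on v_{i+1} weigh 2^(n-1-i) 3^i: shifting a pebble back lowers its weight by a factor 2/3,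
-- and a jump replaces two pebbles by one that is only 3/2 times as heavy.
weight : ∀ {n} → Fin n → ℕ
weight {suc n} zero    = 2 ^ n
weight         (suc i) = 3 * weight i

potential : ∀ {n} → Position n → ℕ
potential         []       = 0
potential {suc n} (x ∷ xs) = x * 2 ^ n + 3 * potential xs

weight-positive : ∀ {n} (i : Fin n) → 0 < weight i
weight-positive {suc n} zero    = m^n>0 2 n
weight-positive         (suc i) = ≤-trans (weight-positive i) (m≤m+n (weight i) _)

2*[3*a]≡3*[2*a] : ∀ a → 2 * (3 * a) ≡ 3 * (2 * a)
2*[3*a]≡3*[2*a] a = trans (sym (*-assoc 2 3 a)) (*-assoc 3 2 a)

weight-step : ∀ {n} (i j : Fin n) → toℕ i ≡ suc (toℕ j) → 2 * weight i ≡ 3 * weight j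
weight-step {suc (suc n)} (suc zero)    zero    _     = 2*[3*a]≡3*[2*a] (2 ^ n)
weight-step               (suc (suc i)) zero    ()
weight-step               (suc i)       (suc j) i≡1+j =
  trans (2*[3*a]≡3*[2*a] (weight i)) (cong (3 *_) (weight-step i j (suc-injective i≡1+j)))

weight-increasing : ∀ {n} {i j : Fin n} → toℕ i ≡ suc (toℕ j) → weight j < weight i
weight-increasing {i = i} {j} i≡1+j = *-cancelˡ-< 2 (weight j) (weight i) (begin-strict
  2 * weight j ≡⟨ *-comm 2 (weight j) ⟩
  weight j * 2 <⟨ *-monoʳ-< (weight j) {{>-nonZero (weight-positive j)}} (n<1+n 2) ⟩
  weight j * 3 ≡⟨ *-comm (weight j) 3 ⟩
  3 * weight j ≡⟨ weight-step i j i≡1+j ⟨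
  2 * weight i ∎)
  where open ≤-Reasoning

weight-next-<-2* : ∀ {n} {i j : Fin n} → toℕ j ≡ suc (toℕ i) → weight j < 2 * weight i
weight-next-<-2* {i = i} {j} j≡1+i = *-cancelˡ-< 2 (weight j) (2 * weight i) (begin-strict
  2 * weight j       ≡⟨ weight-step j i j≡1+i ⟩
  3 * weight i       <⟨ *-monoˡ-< (weight i) {{>-nonZero (weight-positive i)}} (n<1+n 3) ⟩
  4 * weight i       ≡⟨ *-assoc 2 2 (weight i) ⟩
  2 * (2 * weight i) ∎)
  where open ≤-Reasoning

potential-update : ∀ {n} (p : Position n) (i : Fin n) (f : ℕ → ℕ) →
                   potential (p [ i ]%= f) + lookup p i * weight i ≡ potential p + f (lookup p i) * weight i
potential-update {suc n} (x ∷ xs) zero    f = lemma (f x) x (2 ^ n) (3 * potential xs)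
  where
  lemma : ∀ a b c d → a * c + d + b * c ≡ b * c + d + a * c
  lemma = solve-∀
potential-update {suc n} (x ∷ xs) (suc i) f = begin
  x * 2 ^ n + 3 * potential (xs [ i ]%= f) + lookup xs i * (3 * weight i)
    ≡⟨ lemma (x * 2 ^ n) (potential (xs [ i ]%= f)) (lookup xs i) (weight i) ⟩
  x * 2 ^ n + 3 * (potential (xs [ i ]%= f) + lookup xs i * weight i)
    ≡⟨ cong (λ t → x * 2 ^ n + 3 * t) (potential-update xs i f) ⟩
  x * 2 ^ n + 3 * (potential xs + f (lookup xs i) * weight i)
    ≡⟨ lemma (x * 2 ^ n) (potential xs) (f (lookup xs i)) (weight i) ⟨
  x * 2 ^ n + 3 * potential xs + f (lookup xs i) * (3 * weight i) ∎
  where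
  open ≡-Reasoning
  lemma : ∀ a b c d → a + 3 * b + c * (3 * d) ≡ a + 3 * (b + c * d)
  lemma = solve-∀

potential-remove : ∀ {n} (p : Position n) (i : Fin n) (f : ℕ → ℕ) {k} → f (lookup p i) + k ≡ lookup p i →
                   potential (p [ i ]%= f) + k * weight i ≡ potential p
potential-remove p i f {k} removed = +-cancelʳ-≡ (y′ * w) (P′ + k * w) (potential p) (begin
  P′ + k * w + y′ * w   ≡⟨ +-assoc P′ (k * w) (y′ * w) ⟩
  P′ + (k * w + y′ * w) ≡⟨ cong (P′ +_) (*-distribʳ-+ w k y′) ⟨
  P′ + (k + y′) * w     ≡⟨ cong (λ t → P′ + t * w) (trans (+-comm k y′) removed) ⟩
  P′ + y * w            ≡⟨ potential-update p i f ⟩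
  potential p + y′ * w  ∎)
  where
  open ≡-Reasoning
  P′ = potential (p [ i ]%= f)
  w  = weight i
  y  = lookup p i
  y′ = f y

potential-add : ∀ {n} (p : Position n) (i : Fin n) (f : ℕ → ℕ) {k} → f (lookup p i) ≡ lookup p i + k →
                potential (p [ i ]%= f) ≡ potential p + k * weight i
potential-add p i f {k} added = +-cancelʳ-≡ (y * w) P′ (potential p + k * w) (begin
  P′ + y * w                    ≡⟨ potential-update p i f ⟩
  potential p + f y * w         ≡⟨ cong (λ t → potential p + t * w) added ⟩
  potential p + (y + k) * w     ≡⟨ cong (potential p +_) (trans (*-distribʳ-+ w y k) (+-comm (y * w) (k * w))) ⟩
  potential p + (k * w + y * w) ≡⟨ +-assoc (potential p) (k * w) (y * w) ⟨
  potential p + k * w + y * w   ∎)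
  where
  open ≡-Reasoning
  P′ = potential (p [ i ]%= f)
  w  = weight i
  y  = lookup p i

potential-transfer-< : ∀ {n} (p : Position n) {i j : Fin n} {f g : ℕ → ℕ} {a b} →
                       f (lookup p i) + a ≡ lookup p i → g (lookup (p [ i ]%= f) j) ≡ lookup (p [ i ]%= f) j + b →
                       b * weight j < a * weight i → potential ((p [ i ]%= f) [ j ]%= g) < potential p
potential-transfer-< p {i} {j} {f} {g} {a} {b} removed added lighter = begin-strict
  potential ((p [ i ]%= f) [ j ]%= g)    ≡⟨ potential-add (p [ i ]%= f) j g added ⟩
  potential (p [ i ]%= f) + b * weight j <⟨ +-monoʳ-< (potential (p [ i ]%= f)) lighter ⟩
  potential (p [ i ]%= f) + a * weight i ≡⟨ potential-remove p i f removed ⟩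
  potential p                            ∎
  where open ≤-Reasoning

move-decreases-potential : ∀ {n} {p q : Position n} → Move p q → potential q < potential p
move-decreases-potential {p = p} (shift j i i≡1+j k@(suc _) _ k≤pᵢ) =
  potential-transfer-< p (m∸n+n≡m k≤pᵢ) refl (*-monoʳ-< k (weight-increasing i≡1+j))
move-decreases-potential {p = p} (jump i j j≡1+i 2≤pᵢ) =
  potential-transfer-< p (m∸n+n≡m 2≤pᵢ) (+-comm 1 _)
    (subst (_< 2 * weight i) (sym (*-identityˡ (weight j))) (weight-next-<-2* j≡1+i))

options-wellFounded : ∀ {n} → WellFounded (flip (Move {n}))
options-wellFounded = Subrelation.wellFounded move-decreases-potential (On.wellFounded potential <-wellFounded)

evenNimSum-isGrundy : ∀ {n} (p : Position n) → Acc (flip Move) p → HasGrundy p (evenNimSum p)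
evenNimSum-isGrundy p (acc smaller) = mex
  (λ q move → evenNimSum q , evenNimSum-isGrundy q (smaller move) , move-changes-evenNimSum move)
  (λ m m<E → let q , move , value = move-to-smaller-evenNimSum p m<E in
             q , move , subst (HasGrundy q) value (evenNimSum-isGrundy q (smaller move)))

theorem8 : (n : ℕ) (p : Position n) → HasGrundy p (evenNimSum p)
theorem8 n p = evenNimSum-isGrundy p (options-wellFounded p)
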